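{- Let $\pi \in Bl_{n,k}$ ($n \ge 2$). Then \[ \pi_{n-1} \in \begin{cases} Bl_{n-1,k-1}, & \text{if } \pi^{ -1}(n) = n;\\ Bl_{n-1,k}, & \text{otherwise.} \end{cases} \]
   Context: $\S_n(321)$ is the set of $321$-avoiding permutations in $\S_n$, $\mathrm{bl}(\pi)=|\{i : \pi(j)\le i \text{ for all } j\le i\}|$ is the block number, and $Bl_{n,k}=\{\pi\in\S_n(321):\mathrm{bl}(\pi)=k\}$. For $\pi\in\S_n(321)$, $n\ge2$, the permutation $\pi_{n-1}\in\S_{n-1}$ is obtained by deleting the letter $n$ from $\pi$ if $\pi^{ -1}(n-1)<\pi^{ -1}(n)$ (in particular if $\pi^{ -1}(n)=n$), and by deleting the letter $n$ from $(n-1,n)\pi$ if $\pi^{ -1}(n)<\pi^{ -1}(n-1)$ (in which case $n-1$ is the last letter of $\pi$). -}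

module Defs where

open import Data.Nat using (ℕ; zero; suc)
open import Data.Fin using (Fin; fromℕ; inject₁; _≤_; _<_; _≤?_; _<?_)
open import Data.Fin.Properties using (all?)
open import Data.Fin.Permutation using (Permutation′; _⟨$⟩ʳ_; _⟨$⟩ˡ_; remove; transpose; _∘ₚ_)
open import Data.List using (List; length; filter)
open import Data.List using () renaming (map to lmap)
open import Data.Product using (_×_)
open import Relation.Nullary using (¬_; Dec; yes; no)
open import Relation.Nullary.Decidable using (_→-dec_)
open import Relation.Binary.PropositionalEquality using (_≡_)

-- Conventions: a permutation of [n] = {1,…,n} is a bijection Fin n ↔ Fin n;
-- position i / letter v of the paper (1-based) is the Fin element i-1 / v-1.
-- π ⟨$⟩ʳ i is π(i+1)-1, π ⟨$⟩ˡ v is π⁻¹(v+1)-1.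

allFin : (n : ℕ) → List (Fin n)
allFin zero = Data.List.List.[]
allFin (suc n) = Fin.zero Data.List.List.∷ lmap Fin.suc (allFin n)

Avoids321 : {n : ℕ} → Permutation′ n → Set
Avoids321 π = ∀ i j k → i < j → j < k →
  ¬ ((π ⟨$⟩ʳ k) < (π ⟨$⟩ʳ j) × (π ⟨$⟩ʳ j) < (π ⟨$⟩ʳ i))

IsBlockEnd : {n : ℕ} → Permutation′ n → Fin n → Set
IsBlockEnd π i = ∀ j → j ≤ i → (π ⟨$⟩ʳ j) ≤ i

isBlockEnd? : {n : ℕ} (π : Permutation′ n) (i : Fin n) → Dec (IsBlockEnd π i)
isBlockEnd? π i = all? (λ j → (j ≤? i) →-dec ((π ⟨$⟩ʳ j) ≤? i))

bl : {n : ℕ} → Permutation′ n → ℕ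
bl {n} π = length (filter (isBlockEnd? π) (allFin n))

InBl : (n k : ℕ) → Permutation′ n → Set
InBl n k π = Avoids321 π × bl π ≡ k

-- letters n and n-1 (paper, 1-based) in Fin (suc (suc m)), where n = m + 2
letterN : (m : ℕ) → Fin (suc (suc m))
letterN m = fromℕ (suc m)

letterN-1 : (m : ℕ) → Fin (suc (suc m))
letterN-1 m = inject₁ (fromℕ m)

deleteMax : {m : ℕ} → Permutation′ (suc m) → Permutation′ m
deleteMax {m} σ = remove (σ ⟨$⟩ˡ fromℕ m) σ

-- π ↦ π_{n-1}
reduce : {m : ℕ} → Permutation′ (suc (suc m)) → Permutation′ (suc m)
reduce {m} π with (π ⟨$⟩ˡ letterN-1 m) <? (π ⟨$⟩ˡ letterN m)
... | yes _ = deleteMax π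
-- (n-1, n) π : first π, then swap the values n-1 and n
... | no _ = deleteMax (π ∘ₚ transpose (letterN-1 m) (letterN m))

module Submission where

-- A position i < n - 1 is a block end of π exactly when it is one of π_{n-1}.
-- If n - 1 precedes n, then π_{n-1} deletes n: to the left of n nothing
-- changes, and if n lies at or before i then neither permutation has a block
-- end at i, because π has the value n and π_{n-1} the value n - 1 in positions
-- up to i. Otherwise 321-avoidance forces n - 1 to be the last letter of π, so
-- π_{n-1} is π without its last position and with the value n renamed n - 1;
-- both values exceed i, so block ends at i are unaffected. The last position is
-- a block end of both permutations, and position n - 1 is a block end of π
-- exactly when π(n) = n; this accounts for the difference in block number.
-- In both cases π_{n-1} is order-isomorphic to a subsequence of π, so it still
-- avoids 321.

open import Defs
open import Data.Nat using (ℕ; suc; _∸_)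
open import Data.Fin.Permutation using (Permutation′; _⟨$⟩ˡ_)
open import Data.Product using (_×_)
open import Relation.Nullary using (¬_)
open import Relation.Binary.PropositionalEquality using (_≡_)

import Data.Nat as ℕ
open import Data.Nat using (zero; _+_; _≤_; _<_; s≤s)
open import Data.Nat.Properties
  using (+-assoc; +-comm; +-identityʳ; m+n∸n≡m; <-irrefl; <-trans; ≮⇒≥; ≤-pred; <⇒≤;
         ≤-<-trans; <-≤-trans; <⇒≱; ≰⇒>; n<1+n; ≤∧≢⇒<)
open import Data.Fin as Fin using (Fin; toℕ; fromℕ; fromℕ<; inject₁; punchIn; _≟_; _<?_)
open import Data.Fin.Properties
  using (toℕ-injective; toℕ-fromℕ; toℕ-fromℕ<; toℕ-inject₁; toℕ<n; toℕ≤pred[n]; ≤fromℕ;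
         fromℕ≢inject₁; punchIn-mono-≤; punchIn-injective)
  renaming (≤∧≢⇒< to ≤∧≢⇒<ᶠ; <⇒≢ to <⇒≢ᶠ)
open import Data.Fin.Permutation using (_⟨$⟩ʳ_; _∘ₚ_; transpose; inverseˡ; inverseʳ; punchIn-permute′)
open import Data.List using (List; []; _∷_; [_]; _∷ʳ_; _++_; length; filter; map)
open import Data.List.Properties
  using (map-++; map-∘; length-++; length-map; filter-++; filter-accept; filter-reject; filter-≐)
open import Data.Product using (Σ; _,_)
open import Data.Empty using (⊥-elim)
open import Function using (_∘_; _⇔_; mk⇔; Equivalence)
open import Function.Construct.Composition using (_⇔-∘_)
open import Function.Construct.Identity using (⇔-id)
open import Relation.Nullary using (yes; no; contradiction)
open import Relation.Unary using (Decidable)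
open import Relation.Binary.PropositionalEquality
  using (_≢_; refl; sym; trans; cong; subst; subst₂; module ≡-Reasoning)

open Equivalence using (to; from)

private
  variable
    n m t : ℕ

filter-map : ∀ {A B : Set} {P : B → Set} (P? : Decidable P) (f : A → B) (xs : List A) →
             filter P? (map f xs) ≡ map f (filter (P? ∘ f) xs)
filter-map P? f [] = refl
filter-map P? f (x ∷ xs) with P? (f x)
... | yes _ = cong (f x ∷_) (filter-map P? f xs)
... | no _ = filter-map P? f xs

allFin-∷ʳ : ∀ n → allFin (suc n) ≡ map inject₁ (allFin n) ∷ʳ fromℕ n
allFin-∷ʳ zero = refl
allFin-∷ʳ (suc n) = cong (Fin.zero ∷_) (begin
  map Fin.suc (allFin (suc n))
    ≡⟨ cong (map Fin.suc) (allFin-∷ʳ n) ⟩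
  map Fin.suc (map inject₁ (allFin n) ∷ʳ fromℕ n)
    ≡⟨ map-++ Fin.suc (map inject₁ (allFin n)) _ ⟩
  map Fin.suc (map inject₁ (allFin n)) ∷ʳ fromℕ (suc n)
    ≡⟨ cong (_∷ʳ fromℕ (suc n)) (trans (sym (map-∘ (allFin n))) (map-∘ (allFin n))) ⟩
  map inject₁ (map Fin.suc (allFin n)) ∷ʳ fromℕ (suc n) ∎)
  where open ≡-Reasoning

length-filter-allFin-suc : ∀ {P : Fin (suc n) → Set} (P? : Decidable P) →
  length (filter P? (allFin (suc n))) ≡
  length (filter (P? ∘ inject₁) (allFin n)) + length (filter P? [ fromℕ n ])
length-filter-allFin-suc {n} P? = begin
  length (filter P? (allFin (suc n)))
    ≡⟨ cong (length ∘ filter P?) (allFin-∷ʳ n) ⟩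
  length (filter P? (map inject₁ (allFin n) ∷ʳ fromℕ n))
    ≡⟨ cong length (filter-++ P? (map inject₁ (allFin n)) [ fromℕ n ]) ⟩
  length (filter P? (map inject₁ (allFin n)) ++ filter P? [ fromℕ n ])
    ≡⟨ length-++ (filter P? (map inject₁ (allFin n))) ⟩
  length (filter P? (map inject₁ (allFin n))) + #last
    ≡⟨ cong (λ xs → length xs + #last) (filter-map P? inject₁ (allFin n)) ⟩
  length (map inject₁ (filter (P? ∘ inject₁) (allFin n))) + #last
    ≡⟨ cong (_+ #last) (length-map inject₁ (filter (P? ∘ inject₁) (allFin n))) ⟩
  length (filter (P? ∘ inject₁) (allFin n)) + #last ∎
  where
  open ≡-Reasoning
  #last = length (filter P? [ fromℕ n ])

isBlockEnd-last : (σ : Permutation′ (suc n)) → IsBlockEnd σ (fromℕ n)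
isBlockEnd-last σ j _ = ≤fromℕ (σ ⟨$⟩ʳ j)

bl-suc : (σ : Permutation′ (suc n)) →
  bl σ ≡ length (filter (isBlockEnd? σ ∘ inject₁) (allFin n)) + 1
bl-suc {n} σ = trans (length-filter-allFin-suc (isBlockEnd? σ))
  (cong (length (filter (isBlockEnd? σ ∘ inject₁) (allFin n)) +_)
        (cong length (filter-accept (isBlockEnd? σ) (isBlockEnd-last σ))))

-- IsBlockEnd σ i is Closed σ (toℕ i) by definition.
Closed : Permutation′ n → ℕ → Set
Closed σ t = ∀ j → toℕ j ≤ t → toℕ (σ ⟨$⟩ʳ j) ≤ t

closed-cong : {σ : Permutation′ n} {u : ℕ} → t ≡ u → Closed σ t ⇔ Closed σ u
closed-cong {σ = σ} t≡u = mk⇔ (subst (Closed σ) t≡u) (subst (Closed σ) (sym t≡u))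

closed⇒large-position : {σ : Permutation′ n} → Closed σ t →
  ∀ {j} → t < toℕ (σ ⟨$⟩ʳ j) → t < toℕ j
closed⇒large-position c t<σj = ≰⇒> (λ j≤t → <⇒≱ t<σj (c _ j≤t))

⟨$⟩ʳ⇒⟨$⟩ˡ : (π : Permutation′ n) {i v : Fin n} → π ⟨$⟩ʳ i ≡ v → π ⟨$⟩ˡ v ≡ i
⟨$⟩ʳ⇒⟨$⟩ˡ π πi≡v = trans (cong (π ⟨$⟩ˡ_) (sym πi≡v)) (inverseˡ π)

≢fromℕ⇒< : {i : Fin (suc n)} → i ≢ fromℕ n → toℕ i < n
≢fromℕ⇒< {n} {i} i≢n = ≤∧≢⇒< (toℕ≤pred[n] i) (λ e → i≢n (toℕ-injective (trans e (sym (toℕ-fromℕ n)))))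

toℕ-punchIn-< : {i : Fin (suc n)} {j : Fin n} → toℕ j < toℕ i → toℕ (punchIn i j) ≡ toℕ j
toℕ-punchIn-< {i = Fin.zero} ()
toℕ-punchIn-< {i = Fin.suc i} {Fin.zero} _ = refl
toℕ-punchIn-< {i = Fin.suc i} {Fin.suc j} (s≤s j<i) = cong suc (toℕ-punchIn-< j<i)

punchIn-preimage-< : {i j : Fin (suc n)} → toℕ j < toℕ i →
  Σ (Fin n) λ k → toℕ k ≡ toℕ j × punchIn i k ≡ j
punchIn-preimage-< {i = i} {j} j<i = k , toℕ-fromℕ< j<n ,
  toℕ-injective (trans (toℕ-punchIn-< (subst (_< toℕ i) (sym (toℕ-fromℕ< j<n)) j<i)) (toℕ-fromℕ< j<n))
  where
  j<n = <-≤-trans j<i (toℕ≤pred[n] i)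
  k = fromℕ< j<n

punchIn-fromℕ : (i : Fin n) → punchIn (fromℕ n) i ≡ inject₁ i
punchIn-fromℕ {n} i = toℕ-injective (trans
  (toℕ-punchIn-< (subst (toℕ i <_) (sym (toℕ-fromℕ n)) (toℕ<n i))) (sym (toℕ-inject₁ i)))

toℕ-deleteMax : (σ : Permutation′ (suc n)) (i : Fin n) →
  toℕ (deleteMax σ ⟨$⟩ʳ i) ≡ toℕ (σ ⟨$⟩ʳ punchIn (σ ⟨$⟩ˡ fromℕ n) i)
toℕ-deleteMax {n} σ i = sym (trans
  (cong toℕ (trans (punchIn-permute′ σ (fromℕ n) i) (punchIn-fromℕ _))) (toℕ-inject₁ _))

toℕ-deleteMax-fixed : (σ : Permutation′ (suc n)) → σ ⟨$⟩ˡ fromℕ n ≡ fromℕ n →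
  (i : Fin n) → toℕ (deleteMax σ ⟨$⟩ʳ i) ≡ toℕ (σ ⟨$⟩ʳ inject₁ i)
toℕ-deleteMax-fixed σ fixed i = trans (toℕ-deleteMax σ i)
  (cong (λ j → toℕ (σ ⟨$⟩ʳ j)) (trans (cong (λ p → punchIn p i) fixed) (punchIn-fromℕ i)))

-- Below the position of the letter n, deleting n changes neither positions nor values.
deleteMax-closed : (σ : Permutation′ (suc n)) → t < toℕ (σ ⟨$⟩ˡ fromℕ n) →
  Closed σ t ⇔ Closed (deleteMax σ) t
deleteMax-closed {n} {t} σ t<p = mk⇔ restrict extend
  where
  p = σ ⟨$⟩ˡ fromℕ n
  restrict : Closed σ t → Closed (deleteMax σ) t
  restrict c i i≤t = subst (_≤ t) (sym (toℕ-deleteMax σ i))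
    (c (punchIn p i) (subst (_≤ t) (sym (toℕ-punchIn-< (≤-<-trans i≤t t<p))) i≤t))
  extend : Closed (deleteMax σ) t → Closed σ t
  extend c j j≤t with punchIn-preimage-< {i = p} {j} (≤-<-trans j≤t t<p)
  ... | k , k≡j , refl = subst (_≤ t) (toℕ-deleteMax σ k) (c k (subst (_≤ t) (sym k≡j) j≤t))

closed-∘ₚ : (σ ρ : Permutation′ n) → (∀ v → toℕ (ρ ⟨$⟩ʳ v) ≤ t ⇔ toℕ v ≤ t) →
  Closed σ t ⇔ Closed (σ ∘ₚ ρ) t
closed-∘ₚ σ ρ ρ-small = mk⇔
  (λ c j j≤t → from (ρ-small (σ ⟨$⟩ʳ j)) (c j j≤t))
  (λ c j j≤t → to (ρ-small (σ ⟨$⟩ʳ j)) (c j j≤t))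

transpose-matchˡ : (a b : Fin n) → transpose a b ⟨$⟩ʳ a ≡ b
transpose-matchˡ a b with a ≟ a
... | yes _ = refl
... | no a≢a = contradiction refl a≢a

transpose-matchʳ : {a b : Fin n} → b ≢ a → transpose a b ⟨$⟩ʳ b ≡ a
transpose-matchʳ {a = a} {b} b≢a with b ≟ a
... | yes b≡a = contradiction b≡a b≢a
... | no _ with b ≟ b
...   | yes _ = refl
...   | no b≢b = contradiction refl b≢b

transpose-other : {a b v : Fin n} → v ≢ a → v ≢ b → transpose a b ⟨$⟩ʳ v ≡ v
transpose-other {a = a} {b} {v} v≢a v≢b with v ≟ a
... | yes v≡a = contradiction v≡a v≢a
... | no _ with v ≟ b
...   | yes v≡b = contradiction v≡b v≢b
...   | no _ = refl

transpose-small : {a b : Fin n} → t < toℕ a → t < toℕ b →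
  ∀ v → toℕ (transpose a b ⟨$⟩ʳ v) ≤ t ⇔ toℕ v ≤ t
transpose-small {a = a} {b} t<a t<b v with v ≟ a
... | yes refl = mk⇔ (λ b≤t → contradiction b≤t (<⇒≱ t<b)) (λ a≤t → contradiction a≤t (<⇒≱ t<a))
... | no _ with v ≟ b
...   | yes refl = mk⇔ (λ a≤t → contradiction a≤t (<⇒≱ t<a)) (λ b≤t → contradiction b≤t (<⇒≱ t<b))
...   | no _ = ⇔-id _

avoids321-embed : ∀ {a b} (σ : Permutation′ a) (τ : Permutation′ b) (f : Fin b → Fin a) →
  (∀ {x y} → x Fin.< y → f x Fin.< f y) →
  (∀ {x y} → τ ⟨$⟩ʳ x Fin.< τ ⟨$⟩ʳ y → σ ⟨$⟩ʳ f x Fin.< σ ⟨$⟩ʳ f y) →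
  Avoids321 σ → Avoids321 τ
avoids321-embed σ τ f f-mono f-reflects av i j k i<j j<k (τk<τj , τj<τi) =
  av (f i) (f j) (f k) (f-mono i<j) (f-mono j<k) (f-reflects τk<τj , f-reflects τj<τi)

punchIn-mono-< : ∀ (i : Fin (suc n)) {j k} → j Fin.< k → punchIn i j Fin.< punchIn i k
punchIn-mono-< i {j} {k} j<k = ≤∧≢⇒<ᶠ (punchIn-mono-≤ i j k (<⇒≤ j<k)) (<⇒≢ᶠ j<k ∘ punchIn-injective i j k)

deleteMax-avoids321 : (σ : Permutation′ (suc n)) → Avoids321 σ → Avoids321 (deleteMax σ)
deleteMax-avoids321 {n} σ = avoids321-embed σ (deleteMax σ) (punchIn (σ ⟨$⟩ˡ fromℕ n))
  (punchIn-mono-< _) (λ {x} {y} → subst₂ _<_ (toℕ-deleteMax σ x) (toℕ-deleteMax σ y))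

toℕ-letterN : toℕ (letterN m) ≡ suc m
toℕ-letterN {m} = toℕ-fromℕ (suc m)

toℕ-letterN-1 : toℕ (letterN-1 m) ≡ m
toℕ-letterN-1 {m} = trans (toℕ-inject₁ (fromℕ m)) (toℕ-fromℕ m)

value-at-letterN : (π : Permutation′ (suc (suc m))) → toℕ (π ⟨$⟩ʳ (π ⟨$⟩ˡ letterN m)) ≡ suc m
value-at-letterN π = trans (cong toℕ (inverseʳ π)) toℕ-letterN

value-at-letterN-1 : (π : Permutation′ (suc (suc m))) → toℕ (π ⟨$⟩ʳ (π ⟨$⟩ˡ letterN-1 m)) ≡ m
value-at-letterN-1 π = trans (cong toℕ (inverseʳ π)) toℕ-letterN-1

letterN≢letterN-1 : letterN m ≢ letterN-1 m
letterN≢letterN-1 = fromℕ≢inject₁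

<letterN-1 : {v : Fin (suc (suc m))} → v ≢ letterN m → v ≢ letterN-1 m → toℕ v < m
<letterN-1 v≢n v≢n-1 = ≤∧≢⇒< (≤-pred (≢fromℕ⇒< v≢n))
  (λ v≡m → v≢n-1 (toℕ-injective (trans v≡m (sym toℕ-letterN-1))))

letterN-before-letterN-1 : (π : Permutation′ (suc (suc m))) →
  ¬ (π ⟨$⟩ˡ letterN-1 m Fin.< π ⟨$⟩ˡ letterN m) → π ⟨$⟩ˡ letterN m Fin.< π ⟨$⟩ˡ letterN-1 m
letterN-before-letterN-1 π q≮p = ≤∧≢⇒<ᶠ (≮⇒≥ q≮p)
  (λ p≡q → letterN≢letterN-1
    (trans (sym (inverseʳ π)) (trans (cong (π ⟨$⟩ʳ_) p≡q) (inverseʳ π))))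

-- Otherwise n, n - 1 and the last letter would form a 321.
letterN-1-last : (π : Permutation′ (suc (suc m))) → Avoids321 π →
  π ⟨$⟩ˡ letterN m Fin.< π ⟨$⟩ˡ letterN-1 m → π ⟨$⟩ˡ letterN-1 m ≡ letterN m
letterN-1-last {m} π av p<q with (π ⟨$⟩ˡ letterN-1 m) ≟ letterN m
... | yes q≡n = q≡n
... | no q≢n = contradiction (last<n-1 , n-1<n) (av p q (letterN m) p<q q<last)
  where
  p = π ⟨$⟩ˡ letterN m
  q = π ⟨$⟩ˡ letterN-1 m
  q<last : q Fin.< letterN m
  q<last = subst (toℕ q <_) (sym toℕ-letterN) (≢fromℕ⇒< q≢n)
  last≢n : π ⟨$⟩ʳ letterN m ≢ letterN m
  last≢n πl≡n = <-irrefl (cong toℕ (⟨$⟩ʳ⇒⟨$⟩ˡ π πl≡n)) (<-trans p<q q<last)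
  last≢n-1 : π ⟨$⟩ʳ letterN m ≢ letterN-1 m
  last≢n-1 πl≡n-1 = q≢n (⟨$⟩ʳ⇒⟨$⟩ˡ π πl≡n-1)
  last<n-1 : π ⟨$⟩ʳ letterN m Fin.< π ⟨$⟩ʳ q
  last<n-1 = subst (toℕ (π ⟨$⟩ʳ letterN m) <_) (sym (value-at-letterN-1 π)) (<letterN-1 last≢n last≢n-1)
  n-1<n : π ⟨$⟩ʳ q Fin.< π ⟨$⟩ʳ p
  n-1<n = subst₂ _<_ (sym (value-at-letterN-1 π)) (sym (value-at-letterN π)) (n<1+n m)

closed⇔letterN-fixed : (π : Permutation′ (suc (suc m))) →
  Closed π m ⇔ π ⟨$⟩ˡ letterN m ≡ letterN m
closed⇔letterN-fixed {m} π = mk⇔ fixes-n closed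
  where
  p = π ⟨$⟩ˡ letterN m
  fixes-n : Closed π m → p ≡ letterN m
  fixes-n c with p ≟ letterN m
  ... | yes p≡n = p≡n
  ... | no p≢n = contradiction (≤-pred (≢fromℕ⇒< p≢n)) (<⇒≱ (closed⇒large-position {σ = π} c m<πp))
    where
    m<πp : m < toℕ (π ⟨$⟩ʳ p)
    m<πp = subst (m <_) (sym (value-at-letterN π)) (n<1+n m)
  closed : p ≡ letterN m → Closed π m
  closed p≡n j j≤m = ≤-pred (≢fromℕ⇒< πj≢n)
    where
    πj≢n : π ⟨$⟩ʳ j ≢ letterN m
    πj≢n πj≡n = <⇒≱ (n<1+n m) (subst (_≤ m) (trans (cong toℕ j≡n) toℕ-letterN) j≤m)
      where
      j≡n : j ≡ letterN m
      j≡n = trans (sym (⟨$⟩ʳ⇒⟨$⟩ˡ π πj≡n)) p≡n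

isBlockEnd-letterN-1⇔ : (π : Permutation′ (suc (suc m))) →
  IsBlockEnd π (letterN-1 m) ⇔ π ⟨$⟩ˡ letterN m ≡ letterN m
isBlockEnd-letterN-1⇔ π = closed⇔letterN-fixed π ⇔-∘ closed-cong {σ = π} toℕ-letterN-1

deleteMax-closed-ordered : (π : Permutation′ (suc (suc m))) →
  π ⟨$⟩ˡ letterN-1 m Fin.< π ⟨$⟩ˡ letterN m → t < m →
  Closed π t ⇔ Closed (deleteMax π) t
deleteMax-closed-ordered {m} {t} π q<p t<m with t ℕ.<? toℕ (π ⟨$⟩ˡ letterN m)
... | yes t<p = deleteMax-closed π t<p
... | no t≮p = mk⇔ (⊥-elim ∘ not-closed) (⊥-elim ∘ not-closed′)
  where
  p = π ⟨$⟩ˡ letterN m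
  q = π ⟨$⟩ˡ letterN-1 m
  not-closed : ¬ Closed π t
  not-closed c = t≮p (closed⇒large-position {σ = π} c t<πp)
    where
    t<πp : t < toℕ (π ⟨$⟩ʳ p)
    t<πp = subst (t <_) (sym (value-at-letterN π)) (<-trans t<m (n<1+n m))
  not-closed′ : ¬ Closed (deleteMax π) t
  not-closed′ c with punchIn-preimage-< {i = p} {q} q<p
  ... | k , k≡q , pk≡q = <⇒≱ (closed⇒large-position {σ = deleteMax π} c t<π′k) k≤t
    where
    t<π′k : t < toℕ (deleteMax π ⟨$⟩ʳ k)
    t<π′k = subst (t <_)
      (sym (trans (toℕ-deleteMax π k) (trans (cong (λ i → toℕ (π ⟨$⟩ʳ i)) pk≡q) (value-at-letterN-1 π)))) t<m
    k≤t : toℕ k ≤ t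
    k≤t = subst (_≤ t) (sym k≡q) (<⇒≤ (<-≤-trans q<p (≮⇒≥ t≮p)))

swap-inverse-letterN : (π : Permutation′ (suc (suc m))) → π ⟨$⟩ˡ letterN-1 m ≡ letterN m →
  (π ∘ₚ transpose (letterN-1 m) (letterN m)) ⟨$⟩ˡ letterN m ≡ letterN m
swap-inverse-letterN {m} π q≡n = trans (cong (π ⟨$⟩ˡ_) (transpose-matchˡ (letterN m) (letterN-1 m))) q≡n

deleteMax-closed-swapped : (π : Permutation′ (suc (suc m))) →
  π ⟨$⟩ˡ letterN-1 m ≡ letterN m → t < m →
  Closed π t ⇔ Closed (deleteMax (π ∘ₚ transpose (letterN-1 m) (letterN m))) t
deleteMax-closed-swapped {m} {t} π q≡n t<m =
  deleteMax-closed σ t<σ⁻¹n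
  ⇔-∘ closed-∘ₚ π (transpose (letterN-1 m) (letterN m)) (transpose-small t<n-1 t<n)
  where
  σ = π ∘ₚ transpose (letterN-1 m) (letterN m)
  t<n-1 : t < toℕ (letterN-1 m)
  t<n-1 = subst (t <_) (sym toℕ-letterN-1) t<m
  t<n : t < toℕ (letterN m)
  t<n = subst (t <_) (sym toℕ-letterN) (<-trans t<m (n<1+n m))
  t<σ⁻¹n : t < toℕ (σ ⟨$⟩ˡ letterN m)
  t<σ⁻¹n = subst (λ i → t < toℕ i) (sym (swap-inverse-letterN π q≡n)) t<n

swap-reflects-< : {u w : Fin (suc (suc m))} → u ≢ letterN-1 m → w ≢ letterN-1 m →
  transpose (letterN-1 m) (letterN m) ⟨$⟩ʳ u Fin.< transpose (letterN-1 m) (letterN m) ⟨$⟩ʳ w →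
  u Fin.< w
swap-reflects-< {m} {u} {w} u≢n-1 w≢n-1 h with u ≟ letterN m | w ≟ letterN m
... | yes refl | yes refl = contradiction h (<-irrefl refl)
... | yes refl | no w≢n = contradiction (<⇒≤ (<letterN-1 w≢n w≢n-1)) (<⇒≱ h′)
  where
  h′ : m < toℕ w
  h′ = subst₂ _<_ (trans (cong toℕ (transpose-matchʳ letterN≢letterN-1)) toℕ-letterN-1)
         (cong toℕ (transpose-other w≢n-1 w≢n)) h
... | no u≢n | yes refl = subst (toℕ u <_) (sym toℕ-letterN) (<-trans (<letterN-1 u≢n u≢n-1) (n<1+n m))
... | no u≢n | no w≢n =
  subst₂ _<_ (cong toℕ (transpose-other u≢n-1 u≢n)) (cong toℕ (transpose-other w≢n-1 w≢n)) h

deleteMax-avoids321-swapped : (π : Permutation′ (suc (suc m))) → Avoids321 π →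
  π ⟨$⟩ˡ letterN-1 m ≡ letterN m →
  Avoids321 (deleteMax (π ∘ₚ transpose (letterN-1 m) (letterN m)))
deleteMax-avoids321-swapped {m} π av q≡n = avoids321-embed π (deleteMax σ) inject₁
  (λ {x} {y} → subst₂ _<_ (sym (toℕ-inject₁ x)) (sym (toℕ-inject₁ y)))
  (λ {x} {y} h → swap-reflects-< (not-n-1 x) (not-n-1 y) (subst₂ _<_ (value x) (value y) h))
  av
  where
  σ = π ∘ₚ transpose (letterN-1 m) (letterN m)
  value : (i : Fin (suc m)) → toℕ (deleteMax σ ⟨$⟩ʳ i) ≡ toℕ (σ ⟨$⟩ʳ inject₁ i)
  value = toℕ-deleteMax-fixed σ (swap-inverse-letterN π q≡n)
  not-n-1 : (i : Fin (suc m)) → π ⟨$⟩ʳ inject₁ i ≢ letterN-1 m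
  not-n-1 i πi≡n-1 = fromℕ≢inject₁ (trans (sym q≡n) (⟨$⟩ʳ⇒⟨$⟩ˡ π πi≡n-1))

reduce-closed : (π : Permutation′ (suc (suc m))) → Avoids321 π → t < m →
  Closed π t ⇔ Closed (reduce π) t
reduce-closed {m} π av t<m with (π ⟨$⟩ˡ letterN-1 m) <? (π ⟨$⟩ˡ letterN m)
... | yes q<p = deleteMax-closed-ordered π q<p t<m
... | no q≮p = deleteMax-closed-swapped π (letterN-1-last π av (letterN-before-letterN-1 π q≮p)) t<m

reduce-avoids321 : (π : Permutation′ (suc (suc m))) → Avoids321 π → Avoids321 (reduce π)
reduce-avoids321 {m} π av with (π ⟨$⟩ˡ letterN-1 m) <? (π ⟨$⟩ˡ letterN m)
... | yes _ = deleteMax-avoids321 π av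
... | no q≮p = deleteMax-avoids321-swapped π av (letterN-1-last π av (letterN-before-letterN-1 π q≮p))

reduce-isBlockEnd : (π : Permutation′ (suc (suc m))) → Avoids321 π → (j : Fin m) →
  IsBlockEnd π (inject₁ (inject₁ j)) ⇔ IsBlockEnd (reduce π) (inject₁ j)
reduce-isBlockEnd π av j =
  closed-cong {σ = reduce π} (sym (toℕ-inject₁ j))
  ⇔-∘ (reduce-closed π av (toℕ<n j)
  ⇔-∘ closed-cong {σ = π} (trans (toℕ-inject₁ (inject₁ j)) (toℕ-inject₁ j)))

-- The last summand is 1 or 0 according as position n - 1 is a block end of π.
bl-reduce : (π : Permutation′ (suc (suc m))) → Avoids321 π →
  bl π ≡ bl (reduce π) + length (filter (isBlockEnd? π ∘ inject₁) [ fromℕ m ])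
bl-reduce {m} π av = begin
  bl π                  ≡⟨ bl-suc π ⟩
  length (filter (isBlockEnd? π ∘ inject₁) (allFin (suc m))) + 1
                        ≡⟨ cong (_+ 1) (length-filter-allFin-suc {m} (isBlockEnd? π ∘ inject₁)) ⟩
  (A + B) + 1           ≡⟨ +-assoc A B 1 ⟩
  A + (B + 1)           ≡⟨ cong (A +_) (+-comm B 1) ⟩
  A + (1 + B)           ≡⟨ sym (+-assoc A 1 B) ⟩
  (A + 1) + B           ≡⟨ cong (λ a → a + 1 + B) A≡A′ ⟩
  (A′ + 1) + B          ≡⟨ cong (_+ B) (sym (bl-suc (reduce π))) ⟩
  bl (reduce π) + B     ∎
  where
  open ≡-Reasoning
  A A′ B : ℕ
  A = length (filter (isBlockEnd? π ∘ inject₁ ∘ inject₁) (allFin m))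
  A′ = length (filter (isBlockEnd? (reduce π) ∘ inject₁) (allFin m))
  B = length (filter (isBlockEnd? π ∘ inject₁) [ fromℕ m ])
  A≡A′ : A ≡ A′
  A≡A′ = cong length (filter-≐ (isBlockEnd? π ∘ inject₁ ∘ inject₁) (isBlockEnd? (reduce π) ∘ inject₁)
    ((λ {j} → to (reduce-isBlockEnd π av j)) , (λ {j} → from (reduce-isBlockEnd π av j))) (allFin m))

bl-reduce-fixed : (π : Permutation′ (suc (suc m))) → Avoids321 π →
  π ⟨$⟩ˡ letterN m ≡ letterN m → bl π ≡ bl (reduce π) + 1
bl-reduce-fixed π av fixed = trans (bl-reduce π av)
  (cong (λ xs → bl (reduce π) + length xs)
        (filter-accept (isBlockEnd? π ∘ inject₁) (from (isBlockEnd-letterN-1⇔ π) fixed)))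

bl-reduce-moved : (π : Permutation′ (suc (suc m))) → Avoids321 π →
  ¬ (π ⟨$⟩ˡ letterN m ≡ letterN m) → bl π ≡ bl (reduce π)
bl-reduce-moved π av moved = trans (bl-reduce π av) (trans
  (cong (λ xs → bl (reduce π) + length xs)
        (filter-reject (isBlockEnd? π ∘ inject₁) (moved ∘ to (isBlockEnd-letterN-1⇔ π))))
  (+-identityʳ (bl (reduce π))))

lemma4p7 : (m k : ℕ) (π : Permutation′ (suc (suc m))) →
    InBl (suc (suc m)) k π →
    ((π ⟨$⟩ˡ letterN m) ≡ letterN m → InBl (suc m) (k ∸ 1) (reduce π))
    × (¬ ((π ⟨$⟩ˡ letterN m) ≡ letterN m) → InBl (suc m) k (reduce π))
lemma4p7 m k π (av , refl) =
  (λ fixed → reduce-avoids321 π av ,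
     sym (trans (cong (_∸ 1) (bl-reduce-fixed π av fixed)) (m+n∸n≡m (bl (reduce π)) 1))) ,
  (λ moved → reduce-avoids321 π av , sym (bl-reduce-moved π av moved))
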